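{- The hypersequent $J=\ \Rightarrow p\,/\!/\,\Rightarrow\Box(\neg\Box\Box p\land\neg\Box\Box q)\,/\!/\,\Rightarrow q$ is not derivable in (cut-free) $\mathrm{RTB}$.
   Context: Hypersequents $S_1\,/\!/\,\dots\,/\!/\,S_n$ are finite lists of sequents $\Gamma\Rightarrow\Delta$ (pairs of finite sets of formulas). $\mathrm{RTB}$ is the cut-free calculus with: axiom $p\Rightarrow p$ ($p$ atomic); external weakening at the ends ($G$ to $\Rightarrow\,/\!/\,G$, $G$ to $G\,/\!/\,\Rightarrow$); internal weakening ($T\mathrm{L}$, $T\mathrm{R}$) in any component; the usual sequent rules for $\neg,\land,\lor$ in any component; $\Box\mathrm{R}$: from $G\,/\!/\,\Gamma\Rightarrow\Delta\,/\!/\,\Rightarrow\phi$ infer $G\,/\!/\,\Gamma\Rightarrow\Box\phi,\Delta$; $\Box\mathrm{L}$: from $G\,/\!/\,\Gamma\Rightarrow\Delta\,/\!/\,\Sigma,\phi\Rightarrow\Lambda\,/\!/\,H$ infer $G\,/\!/\,\Gamma,\Box\phi\Rightarrow\Delta\,/\!/\,\Sigma\Rightarrow\Lambda\,/\!/\,H$; $Sym$: from $S_1\,/\!/\,\dots\,/\!/\,S_n$ infer $S_n\,/\!/\,\dots\,/\!/\,S_1$; and $T$: from $G\,/\!/\,\Gamma,\phi\Rightarrow\Delta\,/\!/\,G'$ infer $G\,/\!/\,\Gamma,\Box\phi\Rightarrow\Delta\,/\!/\,G'$. -}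

module Defs where

open import Data.Nat using (ℕ)
open import Data.List using (List; []; _∷_; _++_; reverse; [_])
open import Data.List.Relation.Binary.Subset.Propositional using (_⊆_)
open import Data.List.Relation.Binary.Pointwise using (Pointwise)
open import Data.Product using (_×_; _,_)
open import Relation.Nullary using (¬_)

data Fml : Set where
  atom : ℕ → Fml
  ¬'_  : Fml → Fml
  _∧'_ : Fml → Fml → Fml
  _∨'_ : Fml → Fml → Fml
  □_   : Fml → Fml

infixr 9 ¬'_ □_
infixr 7 _∧'_
infixr 6 _∨'_

-- A sequent Γ ⇒ Δ.  Antecedent and succedent are finite sets of formulas,
-- represented by lists taken up to set-equality (see rule `set-eq` below):
-- "Γ, φ" is written φ ∷ Γ.
record Sequent : Set where
  constructor _⇒_
  field
    ant : List Fml
    suc : List Fml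
infix 4 _⇒_

Hyperseq : Set
Hyperseq = List Sequent

_≈set_ : List Fml → List Fml → Set
xs ≈set ys = (xs ⊆ ys) × (ys ⊆ xs)

_≈seq_ : Sequent → Sequent → Set
(Γ ⇒ Δ) ≈seq (Γ' ⇒ Δ') = (Γ ≈set Γ') × (Δ ≈set Δ')

_≈hs_ : Hyperseq → Hyperseq → Set
_≈hs_ = Pointwise _≈seq_

-- The cut-free calculus RTB.  G // S // H is written G ++ S ∷ H.
data RTB : Hyperseq → Set where
  -- sequents are pairs of sets: derivability is invariant under set-equality
  set-eq : ∀ {G G'} → G ≈hs G' → RTB G → RTB G'
  ax     : ∀ p → RTB [ atom p ∷ [] ⇒ atom p ∷ [] ]
  EWl    : ∀ {G} → RTB G → RTB (([] ⇒ []) ∷ G)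
  EWr    : ∀ {G} → RTB G → RTB (G ++ [ [] ⇒ [] ])
  TL     : ∀ {G H Γ Δ φ} → RTB (G ++ (Γ ⇒ Δ) ∷ H) → RTB (G ++ (φ ∷ Γ ⇒ Δ) ∷ H)
  TR     : ∀ {G H Γ Δ φ} → RTB (G ++ (Γ ⇒ Δ) ∷ H) → RTB (G ++ (Γ ⇒ φ ∷ Δ) ∷ H)
  ¬L     : ∀ {G H Γ Δ φ} → RTB (G ++ (Γ ⇒ φ ∷ Δ) ∷ H) → RTB (G ++ (¬' φ ∷ Γ ⇒ Δ) ∷ H)
  ¬R     : ∀ {G H Γ Δ φ} → RTB (G ++ (φ ∷ Γ ⇒ Δ) ∷ H) → RTB (G ++ (Γ ⇒ ¬' φ ∷ Δ) ∷ H)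
  ∧L     : ∀ {G H Γ Δ φ ψ} → RTB (G ++ (φ ∷ ψ ∷ Γ ⇒ Δ) ∷ H)
         → RTB (G ++ ((φ ∧' ψ) ∷ Γ ⇒ Δ) ∷ H)
  ∧R     : ∀ {G H Γ Δ φ ψ} → RTB (G ++ (Γ ⇒ φ ∷ Δ) ∷ H) → RTB (G ++ (Γ ⇒ ψ ∷ Δ) ∷ H)
         → RTB (G ++ (Γ ⇒ (φ ∧' ψ) ∷ Δ) ∷ H)
  ∨L     : ∀ {G H Γ Δ φ ψ} → RTB (G ++ (φ ∷ Γ ⇒ Δ) ∷ H) → RTB (G ++ (ψ ∷ Γ ⇒ Δ) ∷ H)
         → RTB (G ++ ((φ ∨' ψ) ∷ Γ ⇒ Δ) ∷ H)
  ∨R     : ∀ {G H Γ Δ φ ψ} → RTB (G ++ (Γ ⇒ φ ∷ ψ ∷ Δ) ∷ H)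
         → RTB (G ++ (Γ ⇒ (φ ∨' ψ) ∷ Δ) ∷ H)
  □R     : ∀ {G Γ Δ φ} → RTB (G ++ (Γ ⇒ Δ) ∷ ([] ⇒ φ ∷ []) ∷ [])
         → RTB (G ++ [ Γ ⇒ □ φ ∷ Δ ])
  □L     : ∀ {G H Γ Δ Σ Λ φ} → RTB (G ++ (Γ ⇒ Δ) ∷ (φ ∷ Σ ⇒ Λ) ∷ H)
         → RTB (G ++ (□ φ ∷ Γ ⇒ Δ) ∷ (Σ ⇒ Λ) ∷ H)
  Sym    : ∀ {G} → RTB G → RTB (reverse G)
  T      : ∀ {G H Γ Δ φ} → RTB (G ++ (φ ∷ Γ ⇒ Δ) ∷ H) → RTB (G ++ (□ φ ∷ Γ ⇒ Δ) ∷ H)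

p q : Fml
p = atom 0
q = atom 1

J : Hyperseq
J = ([] ⇒ p ∷ []) ∷ ([] ⇒ □ (¬' □ □ p ∧' ¬' □ □ q) ∷ []) ∷ ([] ⇒ q ∷ []) ∷ []

{-# OPTIONS --safe #-}
module Submission where

open import Defs
open import Relation.Nullary using (¬_)
open import Data.Nat using (ℕ; _≡ᵇ_)
open import Data.Bool using (Bool; true; false; not; _∧_; _∨_)
open import Data.Bool.Properties using (not-injective; ∧-conicalˡ; ∧-conicalʳ; ∧-sel; ∨-conicalˡ; ∨-conicalʳ; ∨-sel)
open import Data.Product using (_×_; _,_; proj₁; proj₂)
open import Data.Sum using (_⊎_; [_,_]′)
import Data.Sum as Sum
open import Function using (_∘_)
open import Data.List using (List; []; _∷_; _++_; reverse; [_])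
open import Data.List.Properties using (reverse-involutive)
open import Data.List.Relation.Unary.Any using (here; there)
import Data.List.Relation.Unary.Any.Properties as Any
open import Data.List.Relation.Unary.All using (All; []; _∷_; tabulate; lookup)
open import Data.List.Relation.Unary.All.Properties using (++⁺; ++⁻ˡ; ++⁻ʳ)
open import Data.List.Relation.Binary.Subset.Propositional using (_⊆_)
open import Data.List.Relation.Binary.Subset.Propositional.Properties using (⊆-refl; ⊆-trans; ⊆[]⇒≡[]; All-resp-⊇)
open import Data.List.Relation.Binary.Pointwise as Pointwise using (Pointwise; []; _∷_)
open import Relation.Binary.PropositionalEquality using (_≡_; refl; sym; trans; subst)

{-
Read every formula at a single reflexive world, so that □φ means φ.  Every rule
of RTB is sound for this reading: a derivable hypersequent has no valuation
falsifying all of its components at once.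

A derivation of J can only end with TR, Sym, EWl or EWr (or a set-equality step):
each component of J has an empty antecedent and a succedent consisting of an atom
or a box, and □R acts on the last component, which is the atom p or q.  Below J
the shape is preserved up to reversal, so the first external weakening leaves
two of the three components.  Both such pairs are falsifiable: □(¬□□p ∧ ¬□□q)
collapses to ¬p ∧ ¬q, which is false together with q when p is true, and false
together with p when q is true.
-}

Valuation : Set
Valuation = ℕ → Bool

⟦_⟧ : Fml → Valuation → Bool
⟦ atom n ⟧ V = V n
⟦ ¬' φ ⟧   V = not (⟦ φ ⟧ V)
⟦ φ ∧' ψ ⟧ V = ⟦ φ ⟧ V ∧ ⟦ ψ ⟧ V
⟦ φ ∨' ψ ⟧ V = ⟦ φ ⟧ V ∨ ⟦ ψ ⟧ V
⟦ □ φ ⟧    V = ⟦ φ ⟧ V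

Refutes : Valuation → Sequent → Set
Refutes V (Γ ⇒ Δ) = All (λ φ → ⟦ φ ⟧ V ≡ true) Γ × All (λ φ → ⟦ φ ⟧ V ≡ false) Δ

Refutesₕ : Valuation → Hyperseq → Set
Refutesₕ V = All (Refutes V)

record JointlyFalsifiable (φ ψ : Fml) : Set where
  constructor falsified-by
  field
    valuation : Valuation
    left-false : ⟦ φ ⟧ valuation ≡ false
    right-false : ⟦ ψ ⟧ valuation ≡ false

open JointlyFalsifiable using (valuation)

swap-falsifiable : ∀ {φ ψ} → JointlyFalsifiable φ ψ → JointlyFalsifiable ψ φ
swap-falsifiable (falsified-by V f f′) = falsified-by V f′ f

∧-false : ∀ a b → a ∧ b ≡ false → a ≡ false ⊎ b ≡ false
∧-false a b f = Sum.map (λ e → trans (sym e) f) (λ e → trans (sym e) f) (∧-sel a b)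

∨-true : ∀ a b → a ∨ b ≡ true → a ≡ true ⊎ b ≡ true
∨-true a b t = Sum.map (λ e → trans (sym e) t) (λ e → trans (sym e) t) (∨-sel a b)

_⊆ₛ_ : Sequent → Sequent → Set
(Γ ⇒ Δ) ⊆ₛ (Γ′ ⇒ Δ′) = Γ ⊆ Γ′ × Δ ⊆ Δ′

_⊆ₕ_ : Hyperseq → Hyperseq → Set
_⊆ₕ_ = Pointwise _⊆ₛ_

⊆ₛ-refl : ∀ {S} → S ⊆ₛ S
⊆ₛ-refl {Γ ⇒ Δ} = ⊆-refl , ⊆-refl

⊆ₛ-trans : ∀ {S₁ S₂ S₃} → S₁ ⊆ₛ S₂ → S₂ ⊆ₛ S₃ → S₁ ⊆ₛ S₃
⊆ₛ-trans {_ ⇒ _} {_ ⇒ _} {_ ⇒ _} (Γ₁₂ , Δ₁₂) (Γ₂₃ , Δ₂₃) = ⊆-trans Γ₁₂ Γ₂₃ , ⊆-trans Δ₁₂ Δ₂₃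

≈seq⇒⊆ₛ : ∀ {S S′} → S ≈seq S′ → S ⊆ₛ S′
≈seq⇒⊆ₛ {_ ⇒ _} {_ ⇒ _} ((Γ⊆ , _) , (Δ⊆ , _)) = Γ⊆ , Δ⊆

⊆ₕ-refl : ∀ {G} → G ⊆ₕ G
⊆ₕ-refl = Pointwise.refl ⊆ₛ-refl

⊆ₕ-trans : ∀ {G₁ G₂ G₃} → G₁ ⊆ₕ G₂ → G₂ ⊆ₕ G₃ → G₁ ⊆ₕ G₃
⊆ₕ-trans = Pointwise.transitive ⊆ₛ-trans

⊆ₕ-local : ∀ G {H S S′} → S ⊆ₛ S′ → (G ++ S ∷ H) ⊆ₕ (G ++ S′ ∷ H)
⊆ₕ-local G S⊆S′ = Pointwise.++⁺ ⊆ₕ-refl (S⊆S′ ∷ ⊆ₕ-refl)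

refutes-⊆ₛ : ∀ {V S S′} → S ⊆ₛ S′ → Refutes V S′ → Refutes V S
refutes-⊆ₛ {S = _ ⇒ _} {_ ⇒ _} (Γ⊆ , Δ⊆) (ts , fs) = All-resp-⊇ Γ⊆ ts , All-resp-⊇ Δ⊆ fs

refutesₕ-⊆ₕ : ∀ {V G G′} → G ⊆ₕ G′ → Refutesₕ V G′ → Refutesₕ V G
refutesₕ-⊆ₕ []         []       = []
refutesₕ-⊆ₕ (S⊆ ∷ G⊆) (r ∷ rs) = refutes-⊆ₛ S⊆ r ∷ refutesₕ-⊆ₕ G⊆ rs

module _ {P : Sequent → Set} where

  All-++-local : ∀ G {K K′} → (All P K → All P K′) → All P (G ++ K) → All P (G ++ K′)
  All-++-local G f ps = ++⁺ (++⁻ˡ G ps) (f (++⁻ʳ G ps))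

  All-++-local⊎ : ∀ G {K K₁ K₂} → (All P K → All P K₁ ⊎ All P K₂)
                → All P (G ++ K) → All P (G ++ K₁) ⊎ All P (G ++ K₂)
  All-++-local⊎ G f ps = Sum.map (++⁺ (++⁻ˡ G ps)) (++⁺ (++⁻ˡ G ps)) (f (++⁻ʳ G ps))

  All-reverse⁻ : ∀ xs → All P (reverse xs) → All P xs
  All-reverse⁻ xs ps = tabulate (lookup ps ∘ Any.reverse⁺)

soundness : ∀ {G} → RTB G → (V : Valuation) → ¬ Refutesₕ V G
soundness (set-eq G≈ d) V r = soundness d V (refutesₕ-⊆ₕ (Pointwise.map ≈seq⇒⊆ₛ G≈) r)
soundness (ax n)  V ((t ∷ [] , f ∷ []) ∷ []) with () ← trans (sym t) f
soundness (EWl d) V (_ ∷ r) = soundness d V r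
soundness (EWr {G} d) V r = soundness d V (++⁻ˡ G r)
soundness (TL {G} d) V r = soundness d V (All-++-local G (λ { ((_ ∷ ts , fs) ∷ h) → (ts , fs) ∷ h }) r)
soundness (TR {G} d) V r = soundness d V (All-++-local G (λ { ((ts , _ ∷ fs) ∷ h) → (ts , fs) ∷ h }) r)
soundness (¬L {G} d) V r =
  soundness d V (All-++-local G (λ { ((t ∷ ts , fs) ∷ h) → (ts , not-injective t ∷ fs) ∷ h }) r)
soundness (¬R {G} d) V r =
  soundness d V (All-++-local G (λ { ((ts , f ∷ fs) ∷ h) → (not-injective f ∷ ts , fs) ∷ h }) r)
soundness (∧L {G} {φ = φ} {ψ} d) V r = soundness d V (All-++-local G
  (λ { ((t ∷ ts , fs) ∷ h) → (∧-conicalˡ (⟦ φ ⟧ V) _ t ∷ ∧-conicalʳ _ (⟦ ψ ⟧ V) t ∷ ts , fs) ∷ h }) r)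
soundness (∧R {G} {φ = φ} {ψ} d₁ d₂) V r = [ soundness d₁ V , soundness d₂ V ]′ (All-++-local⊎ G
  (λ { ((ts , f ∷ fs) ∷ h) →
       Sum.map (λ f′ → (ts , f′ ∷ fs) ∷ h) (λ f′ → (ts , f′ ∷ fs) ∷ h) (∧-false (⟦ φ ⟧ V) (⟦ ψ ⟧ V) f) }) r)
soundness (∨L {G} {φ = φ} {ψ} d₁ d₂) V r = [ soundness d₁ V , soundness d₂ V ]′ (All-++-local⊎ G
  (λ { ((t ∷ ts , fs) ∷ h) →
       Sum.map (λ t′ → (t′ ∷ ts , fs) ∷ h) (λ t′ → (t′ ∷ ts , fs) ∷ h) (∨-true (⟦ φ ⟧ V) (⟦ ψ ⟧ V) t) }) r)
soundness (∨R {G} {φ = φ} {ψ} d) V r = soundness d V (All-++-local G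
  (λ { ((ts , f ∷ fs) ∷ h) → (ts , ∨-conicalˡ (⟦ φ ⟧ V) _ f ∷ ∨-conicalʳ _ (⟦ ψ ⟧ V) f ∷ fs) ∷ h }) r)
soundness (□R {G} d) V r =
  soundness d V (All-++-local G (λ { ((ts , f ∷ fs) ∷ []) → (ts , fs) ∷ ([] , f ∷ []) ∷ [] }) r)
soundness (□L {G} d) V r = soundness d V (All-++-local G
  (λ { ((t ∷ ts , fs) ∷ (ts′ , fs′) ∷ h) → (ts , fs) ∷ (t ∷ ts′ , fs′) ∷ h }) r)
soundness (Sym {G} d) V r = soundness d V (All-reverse⁻ G r)
soundness (T {G} d) V r = soundness d V (All-++-local G (λ { ((t ∷ ts , fs) ∷ h) → (t ∷ ts , fs) ∷ h }) r)

Triple : Fml → Fml → Fml → Hyperseq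
Triple α β γ = ([] ⇒ α ∷ []) ∷ ([] ⇒ β ∷ []) ∷ ([] ⇒ γ ∷ []) ∷ []

data Inert : Fml → Set where
  atom : ∀ n → Inert (atom n)
  box  : ∀ φ → Inert (□ φ)

Passive : Sequent → Set
Passive (Γ ⇒ Δ) = Γ ≡ [] × All Inert Δ

passive-⊆ₛ : ∀ {S β} → Inert β → S ⊆ₛ ([] ⇒ β ∷ []) → Passive S
passive-⊆ₛ {_ ⇒ _} β-inert (Γ⊆ , Δ⊆) = ⊆[]⇒≡[] Γ⊆ , All-resp-⊇ Δ⊆ (β-inert ∷ [])

passive-at : ∀ G {H S a b χ} → (G ++ S ∷ H) ⊆ₕ Triple (atom a) (□ χ) (atom b) → Passive S
passive-at G {a = a} {b} {χ} G⊆ =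
  lookup (++⁻ʳ G (all-passive G⊆)) (here refl)
  where
  all-passive : ∀ {K} → K ⊆ₕ Triple (atom a) (□ χ) (atom b) → All Passive K
  all-passive (r₁ ∷ r₂ ∷ r₃ ∷ []) =
    passive-⊆ₛ (atom a) r₁ ∷ passive-⊆ₛ (box χ) r₂ ∷ passive-⊆ₛ (atom b) r₃ ∷ []

⊆ₕ-Triple-init : ∀ G {S α β γ} → (G ++ [ S ]) ⊆ₕ Triple α β γ
               → G ⊆ₕ (([] ⇒ α ∷ []) ∷ ([] ⇒ β ∷ []) ∷ []) × S ⊆ₛ ([] ⇒ γ ∷ [])
⊆ₕ-Triple-init []                    (_ ∷ ())
⊆ₕ-Triple-init (_ ∷ [])              (_ ∷ _ ∷ ())
⊆ₕ-Triple-init (_ ∷ _ ∷ [])          (r₁ ∷ r₂ ∷ r₃ ∷ []) = (r₁ ∷ r₂ ∷ []) , r₃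
⊆ₕ-Triple-init (_ ∷ _ ∷ _ ∷ [])      (_ ∷ _ ∷ _ ∷ ())
⊆ₕ-Triple-init (_ ∷ _ ∷ _ ∷ _ ∷ _)   (_ ∷ _ ∷ _ ∷ ())

refutes-⇒ : ∀ {V φ} → ⟦ φ ⟧ V ≡ false → Refutes V ([] ⇒ φ ∷ [])
refutes-⇒ f = [] , f ∷ []

refutesₕ-pair : ∀ {φ ψ} (F : JointlyFalsifiable φ ψ)
              → Refutesₕ (valuation F) (([] ⇒ φ ∷ []) ∷ ([] ⇒ ψ ∷ []) ∷ [])
refutesₕ-pair (falsified-by _ f f′) = refutes-⇒ f ∷ refutes-⇒ f′ ∷ []

underivable-⊆ₕ-Triple : ∀ {a b χ G}
  → JointlyFalsifiable (atom a) (□ χ) → JointlyFalsifiable (□ χ) (atom b)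
  → G ⊆ₕ Triple (atom a) (□ χ) (atom b) → ¬ RTB G
underivable-⊆ₕ-Triple Fa Fb G⊆ (set-eq G≈ d) =
  underivable-⊆ₕ-Triple Fa Fb (⊆ₕ-trans (Pointwise.map ≈seq⇒⊆ₛ G≈) G⊆) d
underivable-⊆ₕ-Triple Fa Fb (_ ∷ ()) (ax n)
underivable-⊆ₕ-Triple Fa Fb (_ ∷ G⊆) (EWl d) =
  soundness d (valuation Fb) (refutesₕ-⊆ₕ G⊆ (refutesₕ-pair Fb))
underivable-⊆ₕ-Triple Fa Fb G⊆ (EWr {G} d) =
  soundness d (valuation Fa) (refutesₕ-⊆ₕ (proj₁ (⊆ₕ-Triple-init G G⊆)) (refutesₕ-pair Fa))
underivable-⊆ₕ-Triple Fa Fb G⊆ (TL {G} d) with () , _ ← passive-at G G⊆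
underivable-⊆ₕ-Triple Fa Fb G⊆ (TR {G} d) =
  underivable-⊆ₕ-Triple Fa Fb (⊆ₕ-trans (⊆ₕ-local G (⊆-refl , there)) G⊆) d
underivable-⊆ₕ-Triple Fa Fb G⊆ (¬L {G} d) with () , _ ← passive-at G G⊆
underivable-⊆ₕ-Triple Fa Fb G⊆ (¬R {G} d) with _ , () ∷ _ ← passive-at G G⊆
underivable-⊆ₕ-Triple Fa Fb G⊆ (∧L {G} d) with () , _ ← passive-at G G⊆
underivable-⊆ₕ-Triple Fa Fb G⊆ (∧R {G} d₁ d₂) with _ , () ∷ _ ← passive-at G G⊆
underivable-⊆ₕ-Triple Fa Fb G⊆ (∨L {G} d₁ d₂) with () , _ ← passive-at G G⊆
underivable-⊆ₕ-Triple Fa Fb G⊆ (∨R {G} d) with _ , () ∷ _ ← passive-at G G⊆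
underivable-⊆ₕ-Triple Fa Fb G⊆ (□R {G} d) with proj₂ (proj₂ (⊆ₕ-Triple-init G G⊆)) (here refl)
... | here ()
underivable-⊆ₕ-Triple Fa Fb G⊆ (□L {G} d) with () , _ ← passive-at G G⊆
underivable-⊆ₕ-Triple Fa Fb G⊆ (Sym {G} d) =
  underivable-⊆ₕ-Triple (swap-falsifiable Fb) (swap-falsifiable Fa)
    (subst (_⊆ₕ _) (reverse-involutive G) (Pointwise.reverse⁺ G⊆)) d
underivable-⊆ₕ-Triple Fa Fb G⊆ (T {G} d) with () , _ ← passive-at G G⊆

mainTheorem14 : ¬ RTB J
mainTheorem14 =
  underivable-⊆ₕ-Triple (falsified-by only-q refl refl) (falsified-by only-p refl refl) ⊆ₕ-refl
  where
  only-p only-q : Valuation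
  only-p = _≡ᵇ 0
  only-q = _≡ᵇ 1
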